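{- The monoid $\mathcal{L}$ of Left dead ends is an FF-monoid: every Left dead end has a factorisation into atoms, the lengths of its factorisations are bounded, and it has only finitely many factorisations.
   Context: All games are short partizan combinatorial game forms; $G+H$ is the disjunctive sum. Play is misère (a player unable to move wins). Misère outcome classes are ordered $\mathscr L>\mathscr P>\mathscr R$ and $\mathscr L>\mathscr N>\mathscr R$; $G\geq H$ means that for every game $X$ the misère outcome of $G+X$ is $\geq$ that of $H+X$, and $G=H$ means $G\ge H$ and $H\ge G$. A Left dead end is a game no subposition of which (including itself) has a Left option. The Left dead ends, taken up to equality, form a commutative monoid $\mathcal{L}$ under $+$ with identity $0=\{\cdot\mid\cdot\}$, in which $0$ is the only invertible element. An atom is a Left dead end $A\neq 0$ such that whenever $A=H+K$ with $H,K$ Left dead ends, $H=0$ or $K=0$. A factorisation of $G$ is an expression $G=A_1+\dots+A_k$ ($k\geq0$) with atoms $A_i$, considered up to reordering and up to replacing atoms by equal ones; its length is $k$. -}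

module Defs where

open import Data.Nat using (ℕ; zero; suc; _≤_) renaming (_+_ to _+ℕ_)
open import Data.Fin using (Fin; splitAt)
open import Data.Bool using (Bool; true; false; not; _∨_)
open import Data.Sum using (_⊎_; inj₁; inj₂; [_,_]′)
open import Data.Product using (Σ; _×_; _,_)
open import Data.Empty using (⊥)
open import Data.Unit using (⊤)
open import Data.List using (List; []; _∷_; foldr; length)
open import Data.List.Relation.Unary.All using (All)
open import Data.List.Relation.Binary.Permutation.Propositional using (_↭_)
open import Data.List.Relation.Binary.Pointwise using (Pointwise)
open import Relation.Nullary using (¬_)
open import Relation.Binary.PropositionalEquality using (_≡_)

-- Short partizan game forms: finitely many Left options and finitely many
-- Right options, each again a game form (well-founded by construction).
data Game : Set where
  mk : (nL : ℕ) → (Fin nL → Game) → (nR : ℕ) → (Fin nR → Game) → Game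

zeroG : Game
zeroG = mk 0 (λ ()) 0 (λ ())

infixl 6 _+G_
_+G_ : Game → Game → Game
G@(mk nL gL nR gR) +G H@(mk mL hL mR hR) =
  mk (nL +ℕ mL)
     (λ i → [ (λ a → gL a +G H) , (λ b → G +G hL b) ]′ (splitAt nL i))
     (nR +ℕ mR)
     (λ i → [ (λ a → gR a +G H) , (λ b → G +G hR b) ]′ (splitAt nR i))

anyFin : (n : ℕ) → (Fin n → Bool) → Bool
anyFin zero f = false
anyFin (suc n) f = f Fin.zero ∨ anyFin n (λ i → f (Fin.suc i))

-- Misère play: a player unable to move (on their turn) wins.
-- leftFirst G  : Left wins G moving first.
-- rightFirst G : Right wins G moving first.
leftFirst rightFirst : Game → Bool
leftFirst (mk zero gL nR gR) = true
leftFirst (mk (suc n) gL nR gR) = anyFin (suc n) (λ i → not (rightFirst (gL i)))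
rightFirst (mk nL gL zero gR) = true
rightFirst (mk nL gL (suc n) gR) = anyFin (suc n) (λ j → not (leftFirst (gR j)))

data Outcome : Set where
  𝓛 𝓝 𝓟 𝓡 : Outcome

outcome : Game → Outcome
outcome G with leftFirst G | rightFirst G
... | true  | false = 𝓛
... | true  | true  = 𝓝
... | false | false = 𝓟
... | false | true  = 𝓡

data _≤O_ : Outcome → Outcome → Set where
  refl≤ : ∀ {o} → o ≤O o
  R≤P : 𝓡 ≤O 𝓟
  R≤N : 𝓡 ≤O 𝓝
  R≤L : 𝓡 ≤O 𝓛
  P≤L : 𝓟 ≤O 𝓛
  N≤L : 𝓝 ≤O 𝓛

_≥G_ : Game → Game → Set
G ≥G H = (X : Game) → outcome (H +G X) ≤O outcome (G +G X)

_≈G_ : Game → Game → Set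
G ≈G H = (G ≥G H) × (H ≥G G)

IsLeftDeadEnd : Game → Set
IsLeftDeadEnd (mk nL gL nR gR) = (nL ≡ 0) × ((j : Fin nR) → IsLeftDeadEnd (gR j))

IsAtom : Game → Set
IsAtom A =
  IsLeftDeadEnd A × (¬ (A ≈G zeroG)) ×
  ((H K : Game) → IsLeftDeadEnd H → IsLeftDeadEnd K →
     A ≈G (H +G K) → (H ≈G zeroG) ⊎ (K ≈G zeroG))

sumG : List Game → Game
sumG = foldr _+G_ zeroG

IsFactorisation : Game → List Game → Set
IsFactorisation G as = All IsAtom as × (sumG as ≈G G)

SameFactorisation : List Game → List Game → Set
SameFactorisation as bs = Σ (List Game) λ cs → (as ↭ cs) × Pointwise _≈G_ cs bs

{-# OPTIONS --safe #-}
module Submission where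

-- For Left dead ends the misère order is decided by Right options alone: G ≥ H iff
-- H has no Right option when G has none, and every Right option of G is ≥ some Right
-- option of H. Soundness is a strategy argument; conversely, a failure of the test is
-- turned recursively into a game X such that Right, moving first, wins G + X but not
-- H + X.
-- A nonzero dead end has a Right option, so a sum of k atoms allows k consecutive Right
-- moves; hence factorisations of G have length at most the Right height of G, and
-- splitting a non-atom into two nonzero summands lowers the height, which yields a
-- factorisation. Up to equality there are only finitely many dead ends of Right height
-- at most d, since a dead end is determined by the classes of its Right options.
-- Enumerating them makes atomhood decidable and confines all factorisations, up to
-- replacing atoms by equal ones, to a finite list.

open import Defs
open import Data.Bool using (Bool; true; false; not; T)
open import Data.Empty using (⊥-elim)
open import Data.Fin using (Fin; splitAt; _↑ˡ_; _↑ʳ_)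
open import Data.Fin.Properties using (splitAt-↑ˡ; splitAt-↑ʳ; all?; any?; ¬∀⟶∃¬)
open import Data.List using (List; []; _∷_; _++_; map; length; lookup; tabulate; filter; cartesianProduct; cartesianProductWith)
open import Data.List.Extrema.Nat using (max; xs≤max)
open import Data.List.Membership.Propositional using (_∈_; find; lose)
open import Data.List.Membership.Propositional.Properties using (∈-cartesianProduct⁺; ∈-cartesianProduct⁻; ∈-cartesianProductWith⁺; ∈-length; ∈-lookup; ∈-map⁺; ∈-++⁺ˡ; ∈-++⁺ʳ; ∈-filter⁺; ∈-filter⁻)
open import Data.List.Relation.Binary.Permutation.Propositional using (↭-refl)
open import Data.List.Relation.Binary.Pointwise using (Pointwise; []; _∷_; Pointwise-length)
open import Data.List.Relation.Binary.Sublist.Propositional using (_⊆_; []; _∷_; _∷ʳ_; minimum)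
open import Data.List.Relation.Binary.Sublist.Propositional.Properties using (filter-⊆)
open import Data.List.Relation.Unary.All using (All; []; _∷_)
import Data.List.Relation.Unary.All as All
open import Data.List.Relation.Unary.All.Properties using (tabulate⁻; map⁺; ++⁺; all-filter)
open import Data.List.Relation.Unary.Any using (Any; here; there; index)
import Data.List.Relation.Unary.Any as Any
open import Data.List.Relation.Unary.Any.Properties using (lookup-index)
open import Data.Nat using (ℕ; zero; suc; _≤_; z≤n; s≤s; _≟_) renaming (_+_ to _+ℕ_)
open import Data.Nat.Properties using (m+n≡0⇒m≡0; m+n≡0⇒n≡0; ≤-trans; 1+n≰n; n>0⇒n≢0) renaming (+-comm to +ℕ-comm)
open import Data.Product using (Σ; ∃; ∃₂; _×_; _,_; proj₁; proj₂; swap)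
open import Data.Sum using (_⊎_; inj₁; inj₂; [_,_]′)
import Data.Sum as Sum
open import Data.Unit using (⊤; tt)
open import Data.Vec.Functional using () renaming (_∷_ to _◂_)
open import Function using (id; _∘_; _⇔_; mk⇔; Equivalence)
open import Relation.Binary using (IsEquivalence; Setoid)
open import Relation.Binary.PropositionalEquality using (_≡_; refl; subst; sym; trans; cong₂)
import Relation.Binary.Reasoning.Setoid as SetoidReasoning
open import Relation.Nullary using (¬_; ¬?; Dec; yes; no)
open import Relation.Nullary.Decidable using (_×-dec_; _→-dec_; map′)
open import Relation.Nullary.Negation using (¬∃⟶∀¬)
open import Relation.Unary using (Decidable)

-- Moves and winning positions

data Player : Set where
  Left Right : Player

opponent : Player → Player
opponent Left  = Right
opponent Right = Left

#moves : Player → Game → ℕ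
#moves Left  (mk m _ _ _) = m
#moves Right (mk _ _ n _) = n

move : (p : Player) (G : Game) → Fin (#moves p G) → Game
move Left  (mk _ gL _ _) = gL
move Right (mk _ _ _ gR) = gR

AnyMove AllMoves : Player → Game → (Game → Set) → Set
AnyMove  p G P = ∃ λ i → P (move p G i)
AllMoves p G P = ∀ i → P (move p G i)

WinsFirst : Player → Game → Set
WinsFirst Left  G = T (leftFirst G)
WinsFirst Right G = T (rightFirst G)

T-anyFin-not : ∀ n (f : Fin n → Bool) → T (anyFin n (λ i → not (f i))) ⇔ ∃ λ i → ¬ T (f i)
T-anyFin-not zero    f = mk⇔ (λ ()) (λ ())
T-anyFin-not (suc n) f with f Fin.zero in eq
... | false = mk⇔ (λ _ → Fin.zero , subst T eq) (λ _ → tt)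
... | true  = mk⇔ (λ t → let i , p = to t in Fin.suc i , p) from
  where
  open Equivalence (T-anyFin-not n (f ∘ Fin.suc)) using (to) renaming (from to from-suc)
  from : (∃ λ i → ¬ T (f i)) → T (anyFin n (λ i → not (f (Fin.suc i))))
  from (Fin.zero  , ¬t) with () ← ¬t (subst T (sym eq) tt)
  from (Fin.suc i , ¬t) = from-suc (i , ¬t)

winsFirst⇔ : ∀ p G → WinsFirst p G ⇔ (#moves p G ≡ 0 ⊎ AnyMove p G (¬_ ∘ WinsFirst (opponent p)))
winsFirst⇔ Left  (mk zero _ _ _)     = mk⇔ (λ _ → inj₁ refl) (λ _ → tt)
winsFirst⇔ Left  (mk (suc m) gL _ _) = mk⇔ (inj₂ ∘ to) [ (λ ()) , from ]′
  where open Equivalence (T-anyFin-not (suc m) (λ i → rightFirst (gL i)))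
winsFirst⇔ Right (mk _ _ zero _)     = mk⇔ (λ _ → inj₁ refl) (λ _ → tt)
winsFirst⇔ Right (mk _ _ (suc n) gR) = mk⇔ (inj₂ ∘ to) [ (λ ()) , from ]′
  where open Equivalence (T-anyFin-not (suc n) (λ i → leftFirst (gR i)))

noMove⇒wins : ∀ p G → #moves p G ≡ 0 → WinsFirst p G
noMove⇒wins p G = Equivalence.from (winsFirst⇔ p G) ∘ inj₁

goodMove⇒wins : ∀ p G → AnyMove p G (¬_ ∘ WinsFirst (opponent p)) → WinsFirst p G
goodMove⇒wins p G = Equivalence.from (winsFirst⇔ p G) ∘ inj₂

allMovesLose⇒¬wins : ∀ p G → ¬ #moves p G ≡ 0 → AllMoves p G (WinsFirst (opponent p)) → ¬ WinsFirst p G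
allMovesLose⇒¬wins p G moves≢0 allLose wins with Equivalence.to (winsFirst⇔ p G) wins
... | inj₁ noMoves   = moves≢0 noMoves
... | inj₂ (i , ¬wᵢ) = ¬wᵢ (allLose i)

outcome-≤O : ∀ G H → (WinsFirst Left G → WinsFirst Left H) → (WinsFirst Right H → WinsFirst Right G) →
             outcome G ≤O outcome H
outcome-≤O G H l r with leftFirst G | rightFirst G | leftFirst H | rightFirst H
... | true  | false | true  | false = refl≤
... | true  | false | true  | true  = ⊥-elim (r tt)
... | true  | _     | false | _     = ⊥-elim (l tt)
... | true  | true  | true  | true  = refl≤
... | true  | true  | true  | false = N≤L
... | false | false | _     | true  = ⊥-elim (r tt)
... | false | false | true  | false = P≤L
... | false | false | false | false = refl≤
... | false | true  | true  | true  = R≤N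
... | false | true  | true  | false = R≤L
... | false | true  | false | true  = refl≤
... | false | true  | false | false = R≤P

≤O⇒winsRight : ∀ G H → outcome G ≤O outcome H → WinsFirst Right H → WinsFirst Right G
≤O⇒winsRight G H G≤H with leftFirst G | rightFirst G | leftFirst H | rightFirst H | G≤H
... | _     | true  | _     | _     | _  = λ _ → tt
... | _     | false | _     | false | _  = λ ()
... | true  | false | true  | true  | ()
... | true  | false | false | true  | ()
... | false | false | true  | true  | ()
... | false | false | false | true  | ()

#moves-+ : ∀ p G H → #moves p (G +G H) ≡ #moves p G +ℕ #moves p H
#moves-+ Left  (mk _ _ _ _) (mk _ _ _ _) = refl
#moves-+ Right (mk _ _ _ _) (mk _ _ _ _) = refl

noMoves-+⁺ : ∀ p G H → #moves p G ≡ 0 → #moves p H ≡ 0 → #moves p (G +G H) ≡ 0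
noMoves-+⁺ p G H noG noH = trans (#moves-+ p G H) (cong₂ _+ℕ_ noG noH)

noMoves-+⁻ : ∀ p G H → #moves p (G +G H) ≡ 0 → #moves p G ≡ 0 × #moves p H ≡ 0
noMoves-+⁻ p G H noG+H = m+n≡0⇒m≡0 _ sum≡0 , m+n≡0⇒n≡0 (#moves p G) sum≡0
  where sum≡0 = trans (sym (#moves-+ p G H)) noG+H

someMoves-+ˡ : ∀ p G H → ¬ #moves p G ≡ 0 → ¬ #moves p (G +G H) ≡ 0
someMoves-+ˡ p G H someG = someG ∘ proj₁ ∘ noMoves-+⁻ p G H

someMoves-+ʳ : ∀ p G H → ¬ #moves p H ≡ 0 → ¬ #moves p (G +G H) ≡ 0
someMoves-+ʳ p G H someH = someH ∘ proj₂ ∘ noMoves-+⁻ p G H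

+-allMoves : ∀ p (P : Game → Set) G H → AllMoves p G (λ X → P (X +G H)) → AllMoves p H (λ Y → P (G +G Y)) →
             AllMoves p (G +G H) P
+-allMoves Left  P (mk m _ _ _) (mk _ _ _ _) onG onH i with splitAt m i
... | inj₁ a = onG a
... | inj₂ b = onH b
+-allMoves Right P (mk _ _ n _) (mk _ _ _ _) onG onH i with splitAt n i
... | inj₁ a = onG a
... | inj₂ b = onH b

+-anyMoveˡ : ∀ p (P : Game → Set) G H → AnyMove p G (λ X → P (X +G H)) → AnyMove p (G +G H) P
+-anyMoveˡ Left  P (mk m _ _ _) (mk m′ _ _ _) (a , pa) =
  a ↑ˡ m′ , subst (λ s → P ([ _ , _ ]′ s)) (sym (splitAt-↑ˡ m a m′)) pa
+-anyMoveˡ Right P (mk _ _ n _) (mk _ _ n′ _) (a , pa) =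
  a ↑ˡ n′ , subst (λ s → P ([ _ , _ ]′ s)) (sym (splitAt-↑ˡ n a n′)) pa

+-anyMoveʳ : ∀ p (P : Game → Set) G H → AnyMove p H (λ Y → P (G +G Y)) → AnyMove p (G +G H) P
+-anyMoveʳ Left  P (mk m _ _ _) (mk m′ _ _ _) (b , pb) =
  m ↑ʳ b , subst (λ s → P ([ _ , _ ]′ s)) (sym (splitAt-↑ʳ m m′ b)) pb
+-anyMoveʳ Right P (mk _ _ n _) (mk _ _ n′ _) (b , pb) =
  n ↑ʳ b , subst (λ s → P ([ _ , _ ]′ s)) (sym (splitAt-↑ʳ n n′ b)) pb

zeroG-deadEnd : IsLeftDeadEnd zeroG
zeroG-deadEnd = refl , λ ()

deadEnd⇒noLeftMoves : ∀ G → IsLeftDeadEnd G → #moves Left G ≡ 0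
deadEnd⇒noLeftMoves (mk _ _ _ _) = proj₁

deadEnd-rightMove : ∀ G → IsLeftDeadEnd G → AllMoves Right G IsLeftDeadEnd
deadEnd-rightMove (mk _ _ _ _) = proj₂

deadEnd-+ : ∀ {G H} → IsLeftDeadEnd G → IsLeftDeadEnd H → IsLeftDeadEnd (G +G H)
deadEnd-+ {G@(mk _ _ _ _)} {H@(mk _ _ _ _)} dG@(refl , dgR) dH@(refl , dhR) =
  refl , +-allMoves Right IsLeftDeadEnd G H (λ a → deadEnd-+ (dgR a) dH) (λ b → deadEnd-+ dG (dhR b))

deadEnd? : Decidable IsLeftDeadEnd
deadEnd? (mk m _ _ gR) = (m ≟ 0) ×-dec all? (λ j → deadEnd? (gR j))

deadEnd-+-allLeftMoves : ∀ G X (P : Game → Set) → IsLeftDeadEnd G →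
  AllMoves Left X (λ Y → P (G +G Y)) → AllMoves Left (G +G X) P
deadEnd-+-allLeftMoves G@(mk _ _ _ _) X P (refl , _) = +-allMoves Left P G X (λ ())

leftWins-deadEnd-+ : ∀ G Y → IsLeftDeadEnd G → #moves Left Y ≡ 0 → WinsFirst Left (G +G Y)
leftWins-deadEnd-+ G Y dG noY = noMove⇒wins Left (G +G Y) (noMoves-+⁺ Left G Y (deadEnd⇒noLeftMoves G dG) noY)

rightOnly : List Game → Game
rightOnly rs = mk 0 (λ ()) (length rs) (lookup rs)

rightOnly-deadEnd : ∀ {rs} → All IsLeftDeadEnd rs → IsLeftDeadEnd (rightOnly rs)
rightOnly-deadEnd drs = refl , λ k → All.lookup drs (∈-lookup k)

-- The comparison test for Left dead ends

infix 4 _≽_ _≋_ _≽?_ _≋?_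

_≽_ : Game → Game → Set
mk _ _ m gR ≽ mk _ _ n hR = (m ≡ 0 → n ≡ 0) × (∀ i → ∃ λ j → gR i ≽ hR j)

_≋_ : Game → Game → Set
G ≋ H = G ≽ H × H ≽ G

≽-refl : ∀ G → G ≽ G
≽-refl (mk _ _ _ gR) = id , λ i → i , ≽-refl (gR i)

≽-trans : ∀ {G H K} → G ≽ H → H ≽ K → G ≽ K
≽-trans {mk _ _ _ _} {mk _ _ _ _} {mk _ _ _ _} (endGH , simGH) (endHK , simHK) =
  endHK ∘ endGH , λ i → let j , gᵢ≽hⱼ = simGH i ; k , hⱼ≽kₖ = simHK j in k , ≽-trans gᵢ≽hⱼ hⱼ≽kₖ

_≽?_ : ∀ G H → Dec (G ≽ H)
mk _ _ m gR ≽? mk _ _ n hR = (m ≟ 0 →-dec n ≟ 0) ×-dec all? (λ i → any? (λ j → gR i ≽? hR j))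

_≋?_ : ∀ G H → Dec (G ≋ H)
G ≋? H = (G ≽? H) ×-dec (H ≽? G)

≋-isEquivalence : IsEquivalence _≋_
≋-isEquivalence = record
  { refl  = λ {G} → ≽-refl G , ≽-refl G
  ; sym   = swap
  ; trans = λ (G≽H , H≽G) (H≽K , K≽H) → ≽-trans G≽H H≽K , ≽-trans K≽H H≽G
  }

open IsEquivalence ≋-isEquivalence public using () renaming (refl to ≋-refl; sym to ≋-sym; trans to ≋-trans)

≋-setoid : Setoid _ _
≋-setoid = record { isEquivalence = ≋-isEquivalence }

module ≋-Reasoning = SetoidReasoning ≋-setoid

+-mono-≽ : ∀ {G G′ H H′} → G ≽ G′ → H ≽ H′ → G +G H ≽ G′ +G H′
+-mono-≽ {G@(mk _ _ _ _)} {G′@(mk _ _ _ _)} {H@(mk _ _ _ _)} {H′@(mk _ _ _ _)}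
         G≽G′@(endG , simG) H≽H′@(endH , simH) =
  (λ noG+H → let noG , noH = noMoves-+⁻ Right G H noG+H in noMoves-+⁺ Right G′ H′ (endG noG) (endH noH)) ,
  +-allMoves Right (λ X → AnyMove Right (G′ +G H′) (X ≽_)) G H
    (λ a → let a′ , gₐ≽g′ = simG a in +-anyMoveˡ Right (_ ≽_) G′ H′ (a′ , +-mono-≽ gₐ≽g′ H≽H′))
    (λ b → let b′ , hᵦ≽h′ = simH b in +-anyMoveʳ Right (_ ≽_) G′ H′ (b′ , +-mono-≽ G≽G′ hᵦ≽h′))

+-cong : ∀ {G G′ H H′} → G ≋ G′ → H ≋ H′ → G +G H ≋ G′ +G H′
+-cong (G≽G′ , G′≽G) (H≽H′ , H′≽H) = +-mono-≽ G≽G′ H≽H′ , +-mono-≽ G′≽G H′≽H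

+-identityˡ : ∀ G → zeroG +G G ≋ G
+-identityˡ G = shrink G , grow G
  where
  shrink : ∀ G → zeroG +G G ≽ G
  shrink G@(mk _ _ _ gR) = proj₂ ∘ noMoves-+⁻ Right zeroG G ,
    +-allMoves Right (λ X → AnyMove Right G (X ≽_)) zeroG G (λ ()) (λ b → b , shrink (gR b))
  grow : ∀ G → G ≽ zeroG +G G
  grow G@(mk _ _ _ gR) = noMoves-+⁺ Right zeroG G refl ,
    λ b → +-anyMoveʳ Right (gR b ≽_) zeroG G (b , grow (gR b))

+-identityʳ : ∀ G → G +G zeroG ≋ G
+-identityʳ G = shrink G , grow G
  where
  shrink : ∀ G → G +G zeroG ≽ G
  shrink G@(mk _ _ _ gR) = proj₁ ∘ noMoves-+⁻ Right G zeroG ,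
    +-allMoves Right (λ X → AnyMove Right G (X ≽_)) G zeroG (λ a → a , shrink (gR a)) (λ ())
  grow : ∀ G → G ≽ G +G zeroG
  grow G@(mk _ _ _ gR) = (λ noG → noMoves-+⁺ Right G zeroG noG refl) ,
    λ a → +-anyMoveˡ Right (gR a ≽_) G zeroG (a , grow (gR a))

+-assoc : ∀ G H K → (G +G H) +G K ≋ G +G (H +G K)
+-assoc G H K = regroupʳ G H K , regroupˡ G H K
  where
  regroupʳ : ∀ G H K → (G +G H) +G K ≽ G +G (H +G K)
  regroupʳ G@(mk _ _ _ gR) H@(mk _ _ _ hR) K@(mk _ _ _ kR) = end ,
    +-allMoves Right P (G +G H) K
      (+-allMoves Right (λ X → P (X +G K)) G H
        (λ a → +-anyMoveˡ Right (_ ≽_) G (H +G K) (a , regroupʳ (gR a) H K))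
        (λ b → +-anyMoveʳ Right (_ ≽_) G (H +G K)
                 (+-anyMoveˡ Right (λ Y → _ ≽ G +G Y) H K (b , regroupʳ G (hR b) K))))
      (λ c → +-anyMoveʳ Right (_ ≽_) G (H +G K)
               (+-anyMoveʳ Right (λ Y → _ ≽ G +G Y) H K (c , regroupʳ G H (kR c))))
    where
    P : Game → Set
    P X = AnyMove Right (G +G (H +G K)) (X ≽_)
    end : #moves Right ((G +G H) +G K) ≡ 0 → #moves Right (G +G (H +G K)) ≡ 0
    end noAll = let noG+H , noK = noMoves-+⁻ Right (G +G H) K noAll ; noG , noH = noMoves-+⁻ Right G H noG+H
                in noMoves-+⁺ Right G (H +G K) noG (noMoves-+⁺ Right H K noH noK)
  regroupˡ : ∀ G H K → G +G (H +G K) ≽ (G +G H) +G K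
  regroupˡ G@(mk _ _ _ gR) H@(mk _ _ _ hR) K@(mk _ _ _ kR) = end ,
    +-allMoves Right P G (H +G K)
      (λ a → +-anyMoveˡ Right (_ ≽_) (G +G H) K
               (+-anyMoveˡ Right (λ X → _ ≽ X +G K) G H (a , regroupˡ (gR a) H K)))
      (+-allMoves Right (λ Y → P (G +G Y)) H K
        (λ b → +-anyMoveˡ Right (_ ≽_) (G +G H) K
                 (+-anyMoveʳ Right (λ X → _ ≽ X +G K) G H (b , regroupˡ G (hR b) K)))
        (λ c → +-anyMoveʳ Right (_ ≽_) (G +G H) K (c , regroupˡ G H (kR c))))
    where
    P : Game → Set
    P X = AnyMove Right ((G +G H) +G K) (X ≽_)
    end : #moves Right (G +G (H +G K)) ≡ 0 → #moves Right ((G +G H) +G K) ≡ 0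
    end noAll = let noG , noH+K = noMoves-+⁻ Right G (H +G K) noAll ; noH , noK = noMoves-+⁻ Right H K noH+K
                in noMoves-+⁺ Right (G +G H) K (noMoves-+⁺ Right G H noG noH) noK

≽⇒winsLeft  : ∀ {G H} X → IsLeftDeadEnd G → IsLeftDeadEnd H → G ≽ H →
              WinsFirst Left (H +G X) → WinsFirst Left (G +G X)
≽⇒winsRight : ∀ {G H} X → IsLeftDeadEnd G → IsLeftDeadEnd H → G ≽ H →
              WinsFirst Right (G +G X) → WinsFirst Right (H +G X)

≽⇒winsLeft {G@(mk _ _ _ _)} {H@(mk _ _ _ _)} X@(mk _ xL _ _) dG dH G≽H wins =
  [ (λ noMoves → leftWins-deadEnd-+ G X dG (proj₂ (noMoves-+⁻ Left H X noMoves)))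
  , (λ (i , ¬wᵢ) → deadEnd-+-allLeftMoves H X (λ Y → ¬ WinsFirst Right Y → WinsFirst Left (G +G X)) dH
       (λ b ¬wᵦ → goodMove⇒wins Left (G +G X)
                    (+-anyMoveʳ Left (¬_ ∘ WinsFirst Right) G X (b , ¬wᵦ ∘ ≽⇒winsRight (xL b) dG dH G≽H)))
       i ¬wᵢ)
  ]′ (Equivalence.to (winsFirst⇔ Left (H +G X)) wins)

≽⇒winsRight {G@(mk _ _ _ gR)} {H@(mk _ _ _ hR)} X@(mk _ _ _ xR) dG@(_ , dgR) dH@(_ , dhR) G≽H@(end , sim) wins =
  [ (λ noMoves → let noG , noX = noMoves-+⁻ Right G X noMoves in
       noMove⇒wins Right (H +G X) (noMoves-+⁺ Right H X (end noG) noX))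
  , (λ (i , ¬wᵢ) → +-allMoves Right (λ Y → ¬ WinsFirst Left Y → WinsFirst Right (H +G X)) G X
       (λ a ¬wₐ → let j , gₐ≽hⱼ = sim a in goodMove⇒wins Right (H +G X)
                    (+-anyMoveˡ Right (¬_ ∘ WinsFirst Left) H X (j , ¬wₐ ∘ ≽⇒winsLeft X (dgR a) (dhR j) gₐ≽hⱼ)))
       (λ b ¬wᵦ → goodMove⇒wins Right (H +G X)
                    (+-anyMoveʳ Right (¬_ ∘ WinsFirst Left) H X (b , ¬wᵦ ∘ ≽⇒winsLeft (xR b) dG dH G≽H)))
       i ¬wᵢ)
  ]′ (Equivalence.to (winsFirst⇔ Right (G +G X)) wins)

≽⇒≥ : ∀ {G H} → IsLeftDeadEnd G → IsLeftDeadEnd H → G ≽ H → G ≥G H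
≽⇒≥ {G} {H} dG dH G≽H X =
  outcome-≤O (H +G X) (G +G X) (≽⇒winsLeft X dG dH G≽H) (≽⇒winsRight X dG dH G≽H)

integer : ℕ → Game
integer zero    = zeroG
integer (suc n) = mk 1 (λ _ → integer n) 0 (λ ())

firstRightRun : Game → ℕ
firstRightRun (mk _ _ zero    _)  = 0
firstRightRun (mk _ _ (suc _) gR) = suc (firstRightRun (gR Fin.zero))

-- Right keeps taking the first Right option while Left counts the integer down,
-- so Right is the first player left without a move.
rightWins-+firstRightRun : ∀ {G} → IsLeftDeadEnd G → WinsFirst Right (G +G integer (firstRightRun G))
rightWins-+firstRightRun {G@(mk _ _ zero _)} _ = noMove⇒wins Right (G +G zeroG) (noMoves-+⁺ Right G zeroG refl refl)
rightWins-+firstRightRun {G@(mk _ _ (suc _) gR)} (_ , dgR) =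
  goodMove⇒wins Right (G +G N) (+-anyMoveˡ Right (¬_ ∘ WinsFirst Left) G N (Fin.zero ,
    allMovesLose⇒¬wins Left (gR Fin.zero +G N) (someMoves-+ʳ Left (gR Fin.zero) N (λ ()))
      (deadEnd-+-allLeftMoves (gR Fin.zero) N (WinsFirst Right) (dgR Fin.zero)
        (λ _ → rightWins-+firstRightRun (dgR Fin.zero)))))
  where N = integer (firstRightRun G)

SeparatesRight : Game → Game → Game → Set
SeparatesRight G H X = WinsFirst Right (G +G X) × ¬ WinsFirst Right (H +G X)

separatesLeft⇒separatesRight : ∀ G H X → IsLeftDeadEnd H →
  ¬ WinsFirst Left (G +G X) → WinsFirst Left (H +G X) → SeparatesRight G H (rightOnly (X ∷ []))
separatesLeft⇒separatesRight G H X dH ¬wG wH =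
  goodMove⇒wins Right (G +G R) (+-anyMoveʳ Right (¬_ ∘ WinsFirst Left) G R (Fin.zero , ¬wG)) ,
  allMovesLose⇒¬wins Right (H +G R) (someMoves-+ʳ Right H R (λ ()))
    (+-allMoves Right (WinsFirst Left) H R
      (λ a → leftWins-deadEnd-+ (move Right H a) R (deadEnd-rightMove H dH a) refl)
      (λ { Fin.zero → wH }))
  where R = rightOnly (X ∷ [])

separator-noRightMove : ∀ G H → IsLeftDeadEnd G → IsLeftDeadEnd H →
  #moves Right G ≡ 0 → ¬ #moves Right H ≡ 0 → SeparatesRight G H (rightOnly (integer 1 ∷ []))
separator-noRightMove G H dG dH noG someH = separatesLeft⇒separatesRight G H (integer 1) dH ¬wG wH
  where
  ¬wG : ¬ WinsFirst Left (G +G integer 1)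
  ¬wG = allMovesLose⇒¬wins Left (G +G integer 1) (someMoves-+ʳ Left G (integer 1) (λ ()))
          (deadEnd-+-allLeftMoves G (integer 1) (WinsFirst Right) dG
            (λ _ → noMove⇒wins Right (G +G zeroG) (noMoves-+⁺ Right G zeroG noG refl)))
  wH : WinsFirst Left (H +G integer 1)
  wH = goodMove⇒wins Left (H +G integer 1) (+-anyMoveʳ Left (¬_ ∘ WinsFirst Right) H (integer 1) (Fin.zero ,
         allMovesLose⇒¬wins Right (H +G zeroG) (someMoves-+ˡ Right H zeroG someH)
           (+-allMoves Right (WinsFirst Left) H zeroG
             (λ a → leftWins-deadEnd-+ (move Right H a) zeroG (deadEnd-rightMove H dH a) refl) (λ ()))))

-- Right wins G + probe P Ys by moving G to P, as every Left reply in the probe loses;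
-- Left meets each Right move to H^R_j + probe P Ys by moving to H^R_j + Ys j.
probe : Game → ∀ {n} → (Fin n → Game) → Game
probe P Ys = mk _ (integer (firstRightRun P) ◂ Ys) 1 (λ _ → zeroG)

probe-separates : ∀ G H → IsLeftDeadEnd G → IsLeftDeadEnd H → ∀ i (Ys : Fin (#moves Right H) → Game) →
  (∀ j → SeparatesRight (move Right G i) (move Right H j) (Ys j)) →
  SeparatesRight G H (probe (move Right G i) Ys)
probe-separates G H dG dH i Ys sep = rightWins , rightLoses
  where
  Gᵢ = move Right G i
  dGᵢ = deadEnd-rightMove G dG i
  X = probe Gᵢ Ys
  rightWins : WinsFirst Right (G +G X)
  rightWins = goodMove⇒wins Right (G +G X) (+-anyMoveˡ Right (¬_ ∘ WinsFirst Left) G X (i ,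
    allMovesLose⇒¬wins Left (Gᵢ +G X) (someMoves-+ʳ Left Gᵢ X (λ ()))
      (deadEnd-+-allLeftMoves Gᵢ X (WinsFirst Right) dGᵢ
        (λ { Fin.zero → rightWins-+firstRightRun dGᵢ ; (Fin.suc j) → proj₁ (sep j) }))))
  rightLoses : ¬ WinsFirst Right (H +G X)
  rightLoses = allMovesLose⇒¬wins Right (H +G X) (someMoves-+ʳ Right H X (λ ()))
    (+-allMoves Right (WinsFirst Left) H X
      (λ j → goodMove⇒wins Left (move Right H j +G X)
               (+-anyMoveʳ Left (¬_ ∘ WinsFirst Right) (move Right H j) X (Fin.suc j , proj₂ (sep j))))
      (λ _ → leftWins-deadEnd-+ H zeroG dH refl))

¬≽-witness : ∀ G H → ¬ G ≽ H →
  (#moves Right G ≡ 0 × ¬ #moves Right H ≡ 0) ⊎ ∃ λ i → ∀ j → ¬ move Right G i ≽ move Right H j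
¬≽-witness (mk _ _ zero _)     (mk _ _ zero _)    ¬G≽H = ⊥-elim (¬G≽H (id , λ ()))
¬≽-witness (mk _ _ zero _)     (mk _ _ (suc _) _) _    = inj₁ (refl , λ ())
¬≽-witness (mk _ _ (suc m) gR) (mk _ _ _ hR)      ¬G≽H =
  let i , ¬dom = ¬∀⟶∃¬ (suc m) _ (λ i → any? (λ j → gR i ≽? hR j)) (¬G≽H ∘ ((λ ()) ,_))
  in inj₂ (i , ¬∃⟶∀¬ ¬dom)

separator : ∀ G H → IsLeftDeadEnd G → IsLeftDeadEnd H → ¬ G ≽ H → ∃ (SeparatesRight G H)
separator G@(mk _ _ _ gR) H@(mk _ _ _ hR) dG@(_ , dgR) dH@(_ , dhR) ¬G≽H with ¬≽-witness G H ¬G≽H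
... | inj₁ (noG , someH) = rightOnly (integer 1 ∷ []) , separator-noRightMove G H dG dH noG someH
... | inj₂ (i , ¬dom)    =
  probe (gR i) (proj₁ ∘ sep) , probe-separates G H dG dH i (proj₁ ∘ sep) (proj₂ ∘ sep)
  where
  sep : ∀ j → ∃ (SeparatesRight (gR i) (hR j))
  sep j = separator (gR i) (hR j) (dgR i) (dhR j) (¬dom j)

≥⇒≽ : ∀ {G H} → IsLeftDeadEnd G → IsLeftDeadEnd H → G ≥G H → G ≽ H
≥⇒≽ {G} {H} dG dH G≥H with G ≽? H
... | yes G≽H = G≽H
... | no ¬G≽H = let X , wG , ¬wH = separator G H dG dH ¬G≽H in
  ⊥-elim (¬wH (≤O⇒winsRight (H +G X) (G +G X) (G≥H X) wG))

≋⇒≈ : ∀ {G H} → IsLeftDeadEnd G → IsLeftDeadEnd H → G ≋ H → G ≈G H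
≋⇒≈ dG dH (G≽H , H≽G) = ≽⇒≥ dG dH G≽H , ≽⇒≥ dH dG H≽G

≈⇒≋ : ∀ {G H} → IsLeftDeadEnd G → IsLeftDeadEnd H → G ≈G H → G ≋ H
≈⇒≋ dG dH (G≥H , H≥G) = ≥⇒≽ dG dH G≥H , ≥⇒≽ dH dG H≥G

-- Right runs and representatives of bounded Right height

RightRun : Game → ℕ → Set
RightRun G zero    = ⊤
RightRun G (suc d) = AnyMove Right G (λ X → RightRun X d)

≽-rightRun : ∀ {G H} d → G ≽ H → RightRun G d → RightRun H d
≽-rightRun zero _ _ = tt
≽-rightRun {mk _ _ _ _} {mk _ _ _ _} (suc d) (_ , sim) (i , run) =
  let j , gᵢ≽hⱼ = sim i in j , ≽-rightRun d gᵢ≽hⱼ run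

rightRun-+ˡ : ∀ G H d → RightRun G d → RightRun (G +G H) d
rightRun-+ˡ G H zero    _         = tt
rightRun-+ˡ G H (suc d) (i , run) =
  +-anyMoveˡ Right (λ X → RightRun X d) G H (i , rightRun-+ˡ (move Right G i) H d run)

rightRun-+ʳ : ∀ G H d → RightRun H d → RightRun (G +G H) d
rightRun-+ʳ G H zero    _         = tt
rightRun-+ʳ G H (suc d) (j , run) =
  +-anyMoveʳ Right (λ X → RightRun X d) G H (j , rightRun-+ʳ G (move Right H j) d run)

rightRun-+ : ∀ G H a b → RightRun G a → RightRun H b → RightRun (G +G H) (a +ℕ b)
rightRun-+ G H zero    b _          runH = rightRun-+ʳ G H b runH
rightRun-+ G H (suc a) b (i , runG) runH =
  +-anyMoveˡ Right (λ X → RightRun X (a +ℕ b)) G H (i , rightRun-+ (move Right G i) H a b runG runH)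

rightRun-sumG : ∀ {a as} k → a ∈ as → RightRun a k → RightRun (sumG as) k
rightRun-sumG {as = b ∷ bs} k (here refl)  run = rightRun-+ˡ b (sumG bs) k run
rightRun-sumG {as = b ∷ bs} k (there a∈bs) run = rightRun-+ʳ b (sumG bs) k (rightRun-sumG k a∈bs run)

≉0⇒rightRun : ∀ G → ¬ G ≋ zeroG → RightRun G 1
≉0⇒rightRun (mk _ _ zero    _) G≉0 = ⊥-elim (G≉0 ((id , λ ()) , (id , λ ())))
≉0⇒rightRun (mk _ _ (suc _) _) _   = Fin.zero , tt

rightHeight : Game → ℕ
rightHeight (mk _ _ _ gR) = max 0 (tabulate (λ j → suc (rightHeight (gR j))))

rightRun⇒≤rightHeight : ∀ G d → RightRun G d → d ≤ rightHeight G
rightRun⇒≤rightHeight G               zero    _         = z≤n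
rightRun⇒≤rightHeight G@(mk _ _ _ gR) (suc d) (j , run) =
  ≤-trans (s≤s (rightRun⇒≤rightHeight (gR j) d run)) (tabulate⁻ (xs≤max 0 _) j)

¬rightRun-beyondHeight : ∀ G → ¬ RightRun G (suc (rightHeight G))
¬rightRun-beyondHeight G = 1+n≰n ∘ rightRun⇒≤rightHeight G _

sublists : {A : Set} → List A → List (List A)
sublists []       = [] ∷ []
sublists (x ∷ xs) = map (x ∷_) (sublists xs) ++ sublists xs

⊆⇒∈-sublists : {A : Set} {xs ys : List A} → ys ⊆ xs → ys ∈ sublists xs
⊆⇒∈-sublists []                             = here refl
⊆⇒∈-sublists {xs = x ∷ xs} (.x ∷ʳ ys⊆xs)  = ∈-++⁺ʳ (map (x ∷_) (sublists xs)) (⊆⇒∈-sublists ys⊆xs)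
⊆⇒∈-sublists {xs = x ∷ xs} (refl ∷ ys⊆xs) = ∈-++⁺ˡ (∈-map⁺ (x ∷_) (⊆⇒∈-sublists ys⊆xs))

All-sublists : {A : Set} {P : A → Set} {xs : List A} → All P xs → All (All P) (sublists xs)
All-sublists []         = [] ∷ []
All-sublists (px ∷ pxs) = ++⁺ (map⁺ (All.map (px ∷_) (All-sublists pxs))) (All-sublists pxs)

-- A dead end is determined up to ≋ by which classes occur among its Right options.
representatives : ℕ → List Game
representatives zero    = zeroG ∷ []
representatives (suc d) = map rightOnly (sublists (representatives d))

representatives-deadEnds : ∀ d → All IsLeftDeadEnd (representatives d)
representatives-deadEnds zero    = zeroG-deadEnd ∷ []
representatives-deadEnds (suc d) = map⁺ (All.map rightOnly-deadEnd (All-sublists (representatives-deadEnds d)))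

representative : ∀ d H → IsLeftDeadEnd H → ¬ RightRun H (suc d) → ∃ λ r → r ∈ representatives d × H ≋ r
representative zero    (mk _ _ zero    _) _ _     = zeroG , here refl , (id , λ ()) , (id , λ ())
representative zero    (mk _ _ (suc _) _) _ noRun = ⊥-elim (noRun (Fin.zero , tt))
representative (suc d) (mk _ _ zero    _) _ _     =
  rightOnly [] , ∈-map⁺ rightOnly (⊆⇒∈-sublists (minimum (representatives d))) , (id , λ ()) , (id , λ ())
representative (suc d) H@(mk _ _ (suc _) hR) (_ , dhR) noRun =
  rightOnly rs , ∈-map⁺ rightOnly (⊆⇒∈-sublists (filter-⊆ ≋move? (representatives d))) , H≽rs , rs≽H
  where
  rep : ∀ j → ∃ λ r → r ∈ representatives d × hR j ≋ r
  rep j = representative d (hR j) (dhR j) (noRun ∘ (j ,_))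
  ≋move? : ∀ r → Dec (∃ λ j → r ≋ hR j)
  ≋move? r = any? (λ j → r ≋? hR j)
  rs : List Game
  rs = filter ≋move? (representatives d)
  rep∈rs : ∀ j → proj₁ (rep j) ∈ rs
  rep∈rs j = ∈-filter⁺ ≋move? (proj₁ (proj₂ (rep j))) (j , ≋-sym (proj₂ (proj₂ (rep j))))
  H≽rs : H ≽ rightOnly rs
  H≽rs = (λ ()) , λ j →
    index (rep∈rs j) , subst (hR j ≽_) (lookup-index (rep∈rs j)) (proj₁ (proj₂ (proj₂ (rep j))))
  rs≽H : rightOnly rs ≽ H
  rs≽H = ⊥-elim ∘ n>0⇒n≢0 (∈-length (rep∈rs Fin.zero)) , λ k →
    let j , r≋hⱼ = proj₂ (∈-filter⁻ ≋move? {xs = representatives d} (∈-lookup k)) in j , proj₁ r≋hⱼ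

-- Atoms and factorisations

SplitsAs : Game → Game × Game → Set
SplitsAs A (H , K) = A ≋ H +G K × ¬ H ≋ zeroG × ¬ K ≋ zeroG

splitsAs? : ∀ A → Decidable (SplitsAs A)
splitsAs? A (H , K) = (A ≋? H +G K) ×-dec ¬? (H ≋? zeroG) ×-dec ¬? (K ≋? zeroG)

¬splitsAs⇒≋0 : ∀ {A H K} → A ≋ H +G K → ¬ SplitsAs A (H , K) → H ≋ zeroG ⊎ K ≋ zeroG
¬splitsAs⇒≋0 {H = H} {K} A≋H+K ¬splits with H ≋? zeroG | K ≋? zeroG
... | yes H≋0 | _       = inj₁ H≋0
... | no _    | yes K≋0 = inj₂ K≋0
... | no H≉0  | no K≉0  = ⊥-elim (¬splits (A≋H+K , H≉0 , K≉0))

NontrivialSplit : Game → Set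
NontrivialSplit A = ∃ λ ((H , K) : Game × Game) → IsLeftDeadEnd H × IsLeftDeadEnd K × SplitsAs A (H , K)

¬rightRun-summands : ∀ {A H K} n → A ≋ H +G K → ¬ RightRun A n → ¬ RightRun H n × ¬ RightRun K n
¬rightRun-summands {A} {H} {K} n (_ , H+K≽A) noRun =
  noRun ∘ ≽-rightRun n H+K≽A ∘ rightRun-+ˡ H K n , noRun ∘ ≽-rightRun n H+K≽A ∘ rightRun-+ʳ H K n

¬rightRun-nontrivialSummands : ∀ {A H K} n → SplitsAs A (H , K) → ¬ RightRun A (suc n) →
  ¬ RightRun H n × ¬ RightRun K n
¬rightRun-nontrivialSummands {A} {H} {K} n ((_ , H+K≽A) , H≉0 , K≉0) noRun =
  (λ runH → noRun (≽-rightRun (suc n) H+K≽A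
     (subst (RightRun (H +G K)) (+ℕ-comm n 1) (rightRun-+ H K n 1 runH (≉0⇒rightRun K K≉0))))) ,
  (λ runK → noRun (≽-rightRun (suc n) H+K≽A (rightRun-+ H K 1 n (≉0⇒rightRun H H≉0) runK)))

candidateFactors : Game → List Game
candidateFactors A = representatives (rightHeight A)

representativeSummands : ∀ A H K → IsLeftDeadEnd H → IsLeftDeadEnd K → A ≋ H +G K →
  ∃₂ λ rH rK → rH ∈ candidateFactors A × rK ∈ candidateFactors A × H ≋ rH × K ≋ rK
representativeSummands A H K dH dK A≋H+K =
  let noRunH , noRunK = ¬rightRun-summands _ A≋H+K (¬rightRun-beyondHeight A)
      rH , rH∈ , H≋rH = representative (rightHeight A) H dH noRunH
      rK , rK∈ , K≋rK = representative (rightHeight A) K dK noRunK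
  in rH , rK , rH∈ , rK∈ , H≋rH , K≋rK

atom≉0 : ∀ {A} → IsAtom A → ¬ A ≋ zeroG
atom≉0 (dA , A≉0 , _) = A≉0 ∘ ≋⇒≈ dA zeroG-deadEnd

nontrivialSplit⇒¬atom : ∀ {A} → NontrivialSplit A → ¬ IsAtom A
nontrivialSplit⇒¬atom ((H , K) , dH , dK , A≋H+K , H≉0 , K≉0) (dA , _ , indecomposable) =
  [ H≉0 ∘ ≈⇒≋ dH zeroG-deadEnd , K≉0 ∘ ≈⇒≋ dK zeroG-deadEnd ]′
    (indecomposable H K dH dK (≋⇒≈ dA (deadEnd-+ dH dK) A≋H+K))

atom-or-split : ∀ A → IsLeftDeadEnd A → ¬ A ≋ zeroG → IsAtom A ⊎ NontrivialSplit A
atom-or-split A dA A≉0 with Any.any? (splitsAs? A) (cartesianProduct (candidateFactors A) (candidateFactors A))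
... | yes found =
  let (H , K) , HK∈ , splits = find found
      H∈ , K∈ = ∈-cartesianProduct⁻ (candidateFactors A) (candidateFactors A) HK∈
      dRs = representatives-deadEnds (rightHeight A)
  in inj₂ ((H , K) , All.lookup dRs H∈ , All.lookup dRs K∈ , splits)
... | no ¬found = inj₁ (dA , A≉0 ∘ ≈⇒≋ dA zeroG-deadEnd , indecomposable)
  where
  indecomposable : ∀ H K → IsLeftDeadEnd H → IsLeftDeadEnd K → A ≈G (H +G K) → H ≈G zeroG ⊎ K ≈G zeroG
  indecomposable H K dH dK A≈H+K =
    let A≋H+K = ≈⇒≋ dA (deadEnd-+ dH dK) A≈H+K
        rH , rK , rH∈ , rK∈ , H≋rH , K≋rK = representativeSummands A H K dH dK A≋H+K
    in Sum.map (≋⇒≈ dH zeroG-deadEnd ∘ ≋-trans H≋rH) (≋⇒≈ dK zeroG-deadEnd ∘ ≋-trans K≋rK)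
         (¬splitsAs⇒≋0 (≋-trans A≋H+K (+-cong H≋rH K≋rK)) (¬found ∘ lose (∈-cartesianProduct⁺ rH∈ rK∈)))

atom? : Decidable IsAtom
atom? A with deadEnd? A
... | no ¬dA = no (¬dA ∘ proj₁)
... | yes dA with A ≋? zeroG
...   | yes A≋0 = no (λ atom → atom≉0 atom A≋0)
...   | no A≉0  = [ yes , no ∘ nontrivialSplit⇒¬atom ]′ (atom-or-split A dA A≉0)

atom-resp-≋ : ∀ {A B} → IsAtom A → IsLeftDeadEnd B → A ≋ B → IsAtom B
atom-resp-≋ atom@(dA , _ , indecomposable) dB A≋B =
  dB , atom≉0 atom ∘ ≋-trans A≋B ∘ ≈⇒≋ dB zeroG-deadEnd ,
  λ H K dH dK B≈H+K → indecomposable H K dH dK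
    (≋⇒≈ dA (deadEnd-+ dH dK) (≋-trans A≋B (≈⇒≋ dB (deadEnd-+ dH dK) B≈H+K)))

sumAtoms-deadEnd : ∀ {as} → All IsAtom as → IsLeftDeadEnd (sumG as)
sumAtoms-deadEnd []             = zeroG-deadEnd
sumAtoms-deadEnd (atom ∷ atoms) = deadEnd-+ (proj₁ atom) (sumAtoms-deadEnd atoms)

sumG-++ : ∀ as bs → sumG (as ++ bs) ≋ sumG as +G sumG bs
sumG-++ []       bs = ≋-sym (+-identityˡ (sumG bs))
sumG-++ (a ∷ as) bs = begin
  a +G sumG (as ++ bs)        ≈⟨ +-cong (≋-refl {a}) (sumG-++ as bs) ⟩
  a +G (sumG as +G sumG bs)   ≈⟨ ≋-sym (+-assoc a (sumG as) (sumG bs)) ⟩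
  (a +G sumG as) +G sumG bs   ∎
  where open ≋-Reasoning

sumG-cong : ∀ {as bs} → Pointwise _≋_ as bs → sumG as ≋ sumG bs
sumG-cong []            = ≋-refl {zeroG}
sumG-cong (a≋b ∷ as≋bs) = +-cong a≋b (sumG-cong as≋bs)

factorise : ∀ n A → IsLeftDeadEnd A → ¬ RightRun A n → ∃ λ as → All IsAtom as × sumG as ≋ A
factorise zero    A _  noRun = ⊥-elim (noRun tt)
factorise (suc n) A dA noRun with A ≋? zeroG
... | yes A≋0 = [] , [] , ≋-sym A≋0
... | no A≉0 with atom-or-split A dA A≉0
...   | inj₁ atom = A ∷ [] , atom ∷ [] , +-identityʳ A
...   | inj₂ ((H , K) , dH , dK , splits@(A≋H+K , _)) =
  let noRunH , noRunK = ¬rightRun-nontrivialSummands n splits noRun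
      asH , atomsH , ΣH≋H = factorise n H dH noRunH
      asK , atomsK , ΣK≋K = factorise n K dK noRunK
  in asH ++ asK , ++⁺ atomsH atomsK , (begin
       sumG (asH ++ asK)      ≈⟨ sumG-++ asH asK ⟩
       sumG asH +G sumG asK   ≈⟨ +-cong ΣH≋H ΣK≋K ⟩
       H +G K                 ≈⟨ ≋-sym A≋H+K ⟩
       A                      ∎)
  where open ≋-Reasoning

factorisation-exists : ∀ {G} → IsLeftDeadEnd G → ∃ (IsFactorisation G)
factorisation-exists {G} dG =
  let as , atoms , ΣG≋G = factorise _ G dG (¬rightRun-beyondHeight G)
  in as , atoms , ≋⇒≈ (sumAtoms-deadEnd atoms) dG ΣG≋G

rightRun-sumAtoms : ∀ {as} → All IsAtom as → RightRun (sumG as) (length as)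
rightRun-sumAtoms []                       = tt
rightRun-sumAtoms {a ∷ as} (atom ∷ atoms) =
  rightRun-+ a (sumG as) 1 (length as) (≉0⇒rightRun a (atom≉0 atom)) (rightRun-sumAtoms atoms)

factorisation-length≤ : ∀ {G} → IsLeftDeadEnd G → ∀ as → IsFactorisation G as → length as ≤ rightHeight G
factorisation-length≤ {G} dG as (atoms , ΣG≈G) =
  rightRun⇒≤rightHeight G _
    (≽-rightRun _ (proj₁ (≈⇒≋ (sumAtoms-deadEnd atoms) dG ΣG≈G)) (rightRun-sumAtoms atoms))

boundedLists : {A : Set} → ℕ → List A → List (List A)
boundedLists zero    xs = [] ∷ []
boundedLists (suc n) xs = [] ∷ cartesianProductWith _∷_ xs (boundedLists n xs)

∈-boundedLists : {A : Set} {xs ys : List A} → ∀ n → All (_∈ xs) ys → length ys ≤ n → ys ∈ boundedLists n xs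
∈-boundedLists zero    []           _          = here refl
∈-boundedLists (suc n) []           _          = here refl
∈-boundedLists (suc n) (y∈ ∷ ys∈) (s≤s len≤) =
  there (∈-cartesianProductWith⁺ _∷_ y∈ (∈-boundedLists n ys∈ len≤))

factorisation? : ∀ {G} → IsLeftDeadEnd G → Decidable (IsFactorisation G)
factorisation? {G} dG as with All.all? atom? as
... | no ¬atoms = no (¬atoms ∘ proj₁)
... | yes atoms = map′ (atoms ,_) proj₂ (map′ (≋⇒≈ dΣ dG) (≈⇒≋ dΣ dG) (sumG as ≋? G))
  where dΣ = sumAtoms-deadEnd atoms

atomRepresentatives : ∀ d as → All IsAtom as → (∀ {a} → a ∈ as → ¬ RightRun a (suc d)) →
  ∃ λ bs → All (_∈ representatives d) bs × All IsAtom bs × Pointwise _≋_ as bs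
atomRepresentatives d []       []             _     = [] , [] , [] , []
atomRepresentatives d (a ∷ as) (atom ∷ atoms) short =
  let r , r∈ , a≋r = representative d a (proj₁ atom) (short (here refl))
      bs , bs∈ , atomsBs , as≋bs = atomRepresentatives d as atoms (short ∘ there)
      r-atom = atom-resp-≋ atom (All.lookup (representatives-deadEnds d) r∈) a≋r
  in r ∷ bs , r∈ ∷ bs∈ , r-atom ∷ atomsBs , a≋r ∷ as≋bs

pointwise-≋⇒≈ : ∀ {as bs} → All IsLeftDeadEnd as → All IsLeftDeadEnd bs →
  Pointwise _≋_ as bs → Pointwise _≈G_ as bs
pointwise-≋⇒≈ []         []         []            = []
pointwise-≋⇒≈ (da ∷ das) (db ∷ dbs) (a≋b ∷ as≋bs) = ≋⇒≈ da db a≋b ∷ pointwise-≋⇒≈ das dbs as≋bs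

candidateFactorisations : Game → List (List Game)
candidateFactorisations G = boundedLists (rightHeight G) (representatives (rightHeight G))

factorisations : ∀ {G} → IsLeftDeadEnd G → List (List Game)
factorisations {G} dG = filter (factorisation? dG) (candidateFactorisations G)

factorisations-complete : ∀ {G} (dG : IsLeftDeadEnd G) as → IsFactorisation G as →
  Any (SameFactorisation as) (factorisations dG)
factorisations-complete {G} dG as fact@(atoms , ΣG≈G) =
  lose (∈-filter⁺ (factorisation? dG) (∈-boundedLists D bs∈ length≤) bsFactorisation)
       (as , ↭-refl , pointwise-≋⇒≈ (All.map proj₁ atoms) (All.map proj₁ atomsBs) as≋bs)
  where
  D = rightHeight G
  ΣG≋G : sumG as ≋ G
  ΣG≋G = ≈⇒≋ (sumAtoms-deadEnd atoms) dG ΣG≈G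
  short : ∀ {a} → a ∈ as → ¬ RightRun a (suc D)
  short a∈as = ¬rightRun-beyondHeight G ∘ ≽-rightRun _ (proj₁ ΣG≋G) ∘ rightRun-sumG _ a∈as
  reps = atomRepresentatives D as atoms short
  bs = proj₁ reps
  bs∈ = proj₁ (proj₂ reps)
  atomsBs = proj₁ (proj₂ (proj₂ reps))
  as≋bs = proj₂ (proj₂ (proj₂ reps))
  bsFactorisation : IsFactorisation G bs
  bsFactorisation = atomsBs , ≋⇒≈ (sumAtoms-deadEnd atomsBs) dG (≋-trans (≋-sym (sumG-cong as≋bs)) ΣG≋G)
  length≤ : length bs ≤ D
  length≤ = subst (_≤ D) (Pointwise-length as≋bs) (factorisation-length≤ dG as fact)

mainTheorem6 : (G : Game) → IsLeftDeadEnd G →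
    (Σ (List Game) λ as → IsFactorisation G as)
    × (Σ ℕ λ N → (as : List Game) → IsFactorisation G as → length as ≤ N)
    × (Σ (List (List Game)) λ fs →
         All (IsFactorisation G) fs
         × ((as : List Game) → IsFactorisation G as → Any (SameFactorisation as) fs))
mainTheorem6 G dG =
  factorisation-exists dG ,
  (rightHeight G , factorisation-length≤ dG) ,
  (factorisations dG , all-filter (factorisation? dG) (candidateFactorisations G) , factorisations-complete dG)
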